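{- Let $G$ be a finite connected undirected unweighted graph whose edge set is covered by shortest paths $\mu_1,\dots,\mu_k$ (the base paths). For any pair of vertices $a,b$ of $G$, there exists a well-coloured $a$-$b$ path $(P,\operatorname{col})$ such that $P$ is a shortest $a$-$b$ path.
   Context: Paths are simple. For an edge $e$, $\operatorname{colours}(e)=\{c\in\{1,\dots,k\}: e\in E(\mu_c)\}$. A colouring of a path $P$ is a map $\operatorname{col}:E(P)\to\{1,\dots,k\}$ with $\operatorname{col}(e)\in\operatorname{colours}(e)$ for each edge $e$. It is good if for every colour $c$, the edges of $P$ coloured $c$ form a connected subpath of $P$. A pair $(P,\operatorname{col})$ with $\operatorname{col}$ good is a well-coloured path. -}

module Defs where

open import Data.Nat using (ℕ; suc; _≤_)
open import Data.Fin using (Fin; zero; suc; inject₁; fromℕ) renaming (_≤_ to _≤ᶠ_)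
open import Data.Bool using (Bool; true; false)
open import Data.Product using (Σ; ∃; _×_; _,_)
open import Data.Sum using (_⊎_)
open import Relation.Binary.PropositionalEquality using (_≡_)
open import Function.Definitions using (Injective)

record Graph (n : ℕ) : Set where
  field
    adj   : Fin n → Fin n → Bool
    sym   : ∀ u v → adj u v ≡ adj v u
    irrefl : ∀ u → adj u u ≡ false

open Graph public

Adj : ∀ {n} → Graph n → Fin n → Fin n → Set
Adj G u v = adj G u v ≡ true

record Walk {n : ℕ} (G : Graph n) (a b : Fin n) : Set where
  field
    len   : ℕ
    vert  : Fin (suc len) → Fin n
    start : vert zero ≡ a
    end   : vert (fromℕ len) ≡ b
    step  : ∀ (i : Fin len) → Adj G (vert (inject₁ i)) (vert (suc i))

open Walk public

IsPath : ∀ {n} {G : Graph n} {a b} → Walk G a b → Set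
IsPath W = Injective _≡_ _≡_ (vert W)

IsShortest : ∀ {n} {G : Graph n} {a b} → Walk G a b → Set
IsShortest {G = G} {a} {b} W = ∀ (W' : Walk G a b) → len W ≤ len W'

Connected : ∀ {n} → Graph n → Set
Connected {n} G = ∀ (a b : Fin n) → Walk G a b

record BasePath {n : ℕ} (G : Graph n) : Set where
  field
    src tgt  : Fin n
    walk     : Walk G src tgt
    isPath   : IsPath walk
    shortest : IsShortest walk

open BasePath public

EdgeOf : ∀ {n} {G : Graph n} {a b} → Fin n → Fin n → Walk G a b → Set
EdgeOf u v W = ∃ λ (i : Fin (len W)) →
  (vert W (inject₁ i) ≡ u × vert W (suc i) ≡ v) ⊎
  (vert W (inject₁ i) ≡ v × vert W (suc i) ≡ u)

Covers : ∀ {n} {G : Graph n} {k} → (Fin k → BasePath G) → Set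
Covers {n} {G} μ = ∀ (u v : Fin n) → Adj G u v → ∃ λ c → EdgeOf u v (walk (μ c))

IsColouring : ∀ {n} {G : Graph n} {k} (μ : Fin k → BasePath G) {a b}
  (W : Walk G a b) → (Fin (len W) → Fin k) → Set
IsColouring μ W col =
  ∀ (i : Fin (len W)) → EdgeOf (vert W (inject₁ i)) (vert W (suc i)) (walk (μ (col i)))

-- Good: for each colour, the edges of that colour form a contiguous
-- (hence connected) subpath, i.e. positions of each colour form an interval.
IsGood : ∀ {k} {m : ℕ} → (Fin m → Fin k) → Set
IsGood {m = m} col = ∀ (i j l : Fin m) → i ≤ᶠ j → j ≤ᶠ l → col i ≡ col l → col j ≡ col i

-- Among all base paths μ_c through a, pick a vertex x of μ_c
-- lying on an a–b geodesic with d(a,x) as large as possible. Walk from a to x along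
-- μ_c in colour c (a segment of a shortest path is shortest) and continue with a
-- well-coloured geodesic from x to b, built recursively. Colour c never reappears
-- there: an edge of colour c further on would end at a vertex of μ_c on the a–b
-- geodesic farther from a than x. Vertex i of a path of length d(a,b) lies at
-- distance i from a, so the result is simple.

module Submission where

open import Defs hiding (sym)
open import Data.Bool using (true)
import Data.Bool as Bool
open import Data.Empty using (⊥)
open import Data.Fin using (Fin; zero; suc; toℕ; inject₁; fromℕ)
open import Data.Fin.Properties using (any?; toℕ-fromℕ; toℕ<n; toℕ-injective) renaming (_≟_ to _≟ᶠ_)
open import Data.Nat using (ℕ; zero; suc; _+_; _≤_; _<_; z≤n; s≤s⁻¹)
open import Data.Nat.Induction using (<-rec)
open import Data.Nat.Properties
open import Data.Product using (Σ; ∃; _×_; _,_; proj₁; proj₂)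
open import Data.Sum using (_⊎_; inj₁; inj₂)
open import Data.Unit using (⊤; tt)
open import Relation.Binary.Core using (_⇒_)
open import Relation.Binary.Definitions using (Symmetric) renaming (Decidable to Decidable₂)
open import Relation.Binary.PropositionalEquality
  using (_≡_; _≢_; refl; sym; trans; cong; cong₂; subst; subst₂; module ≡-Reasoning)
open import Relation.Nullary using (Dec; yes; no; ¬_; contradiction)
open import Relation.Nullary.Decidable using (map′; _×-dec_)
open import Relation.Unary using (Decidable)

+-≤-tight : ∀ {m n o p} → m ≤ o → n ≤ p → o + p ≤ m + n → m ≡ o × n ≡ p
+-≤-tight {m} {n} {o} {p} m≤o n≤p o+p≤m+n = m≡o , n≡p
  where
  m≡o : m ≡ o
  m≡o = ≤-antisym m≤o (+-cancelʳ-≤ p o m (≤-trans o+p≤m+n (+-monoʳ-≤ m n≤p)))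
  n≡p : n ≡ p
  n≡p = ≤-antisym n≤p (+-cancelˡ-≤ o p n (subst (λ x → o + p ≤ x + n) m≡o o+p≤m+n))

module _ {P : ℕ → Set} (P? : Decidable P) where

  least : ∀ {n} → P n → Σ ℕ λ m → P m × (∀ {j} → j < m → ¬ P j)
  least {n} = below n ≤-refl
    where
    below : ∀ w {n} → n ≤ w → P n → Σ ℕ λ m → P m × (∀ {j} → j < m → ¬ P j)
    below w {n} n≤w Pn with anyUpTo? P? n
    ... | no ∄ = n , Pn , λ j<n Pj → ∄ (_ , j<n , Pj)
    below (suc w) n≤w Pn | yes (j , j<n , Pj) = below w (s≤s⁻¹ (≤-trans j<n n≤w)) Pj
    below zero    n≤w Pn | yes (j , j<n , Pj) with () ← ≤-trans j<n n≤w

  greatest : ∀ {w n} → (∀ {j} → P j → j ≤ w) → P n → Σ ℕ λ m → P m × (∀ {j} → P j → j ≤ m)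
  greatest {w} bound Pn with P? w
  ... | yes Pw = w , Pw , bound
  greatest {zero}  bound Pn | no ¬P0 = contradiction (subst P (n≤0⇒n≡0 (bound Pn)) Pn) ¬P0
  greatest {suc w} bound Pn | no ¬Pw =
    greatest (λ Pj → s≤s⁻¹ (≤∧≢⇒< (bound Pj) λ { refl → ¬Pw Pj })) Pn

data Path {V : Set} (E : V → V → Set) : V → V → ℕ → Set where
  []  : ∀ {a} → Path E a a 0
  _∷_ : ∀ {a v b m} → E a v → Path E v b m → Path E a b (suc m)

infixr 5 _∷_

module _ {V : Set} {E : V → V → Set} where

  infixr 5 _++_

  _++_ : ∀ {a x b m t} → Path E a x m → Path E x b t → Path E a b (m + t)
  []      ++ Q = Q
  (e ∷ P) ++ Q = e ∷ (P ++ Q)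

  map : ∀ {F : V → V → Set} → E ⇒ F → ∀ {a b m} → Path E a b m → Path F a b m
  map f []      = []
  map f (e ∷ P) = f e ∷ map f P

  reverse : Symmetric E → ∀ {a b m} → Path E a b m → Path E b a m
  reverse E-sym []      = []
  reverse E-sym (e ∷ P) = subst (Path E _ _) (+-comm _ 1) (reverse E-sym P ++ E-sym e ∷ [])

  empty⇒≡ : ∀ {a b} → Path E a b 0 → a ≡ b
  empty⇒≡ [] = refl

  vertex : ∀ {a b m} → Path E a b m → Fin (suc m) → V
  vertex {a} _ zero    = a
  vertex (e ∷ P) (suc i) = vertex P i

  vertex-last : ∀ {a b m} (P : Path E a b m) → vertex P (fromℕ m) ≡ b
  vertex-last []      = refl
  vertex-last (e ∷ P) = vertex-last P

  edge : ∀ {a b m} (P : Path E a b m) (i : Fin m) → E (vertex P (inject₁ i)) (vertex P (suc i))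
  edge (e ∷ P) zero    = e
  edge (e ∷ P) (suc i) = edge P i

  splitAt : ∀ {a b m} (P : Path E a b m) (i : Fin (suc m)) →
            Σ ℕ λ t → Path E a (vertex P i) (toℕ i) × Path E (vertex P i) b t × toℕ i + t ≡ m
  splitAt P       zero    = _ , [] , P , refl
  splitAt (e ∷ P) (suc i) with splitAt P i
  ... | t , P₁ , P₂ , eq = t , e ∷ P₁ , P₂ , cong suc eq

  tabulate : ∀ L (f : Fin (suc L) → V) → (∀ i → E (f (inject₁ i)) (f (suc i))) →
             Path E (f zero) (f (fromℕ L)) L
  tabulate zero    f step = []
  tabulate (suc L) f step = step zero ∷ tabulate L (λ i → f (suc i)) (λ i → step (suc i))

  segment : ∀ L (f : Fin (suc L) → V) → (∀ i → E (f (inject₁ i)) (f (suc i))) →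
            ∀ p q → toℕ p ≤ toℕ q → Σ ℕ λ s → Path E (f p) (f q) s × toℕ p + s ≡ toℕ q
  segment L       f step zero    zero    _ = 0 , [] , refl
  segment (suc L) f step zero    (suc q) _ =
    let s , P , eq = segment L (λ i → f (suc i)) (λ i → step (suc i)) zero q z≤n
    in  suc s , step zero ∷ P , cong suc eq
  segment (suc L) f step (suc p) (suc q) p≤q =
    let s , P , eq = segment L (λ i → f (suc i)) (λ i → step (suc i)) p q (s≤s⁻¹ p≤q)
    in  s , P , cong suc eq

path? : ∀ {n} {E : Fin n → Fin n → Set} → Decidable₂ E → ∀ m a b → Dec (Path E a b m)
path? E? zero    a b = map′ (λ { refl → [] }) empty⇒≡ (a ≟ᶠ b)
path? E? (suc m) a b =
  map′ (λ (v , e , P) → e ∷ P) (λ { (e ∷ P) → _ , e , P }) (any? λ v → E? a v ×-dec path? E? m v b)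

module _ {C V : Set} {F : C → V → V → Set} where

  Coloured : V → V → Set
  Coloured u v = Σ C λ c → F c u v

  colours : ∀ {a b m} → Path Coloured a b m → Fin m → C
  colours P i = proj₁ (edge P i)

  paint : ∀ c {a b m} → Path (F c) a b m → Path Coloured a b m
  paint c = map (c ,_)

  Avoids : C → ∀ {a b m} → Path Coloured a b m → Set
  Avoids c P = ∀ i → colours P i ≢ c

  StartsWith : C → ∀ {a b m} → Path Coloured a b m → Set
  StartsWith c []            = ⊥
  StartsWith c ((c′ , _) ∷ _) = c′ ≡ c

  -- Colour classes are intervals iff at each edge the colour either continues or never recurs.
  WellColoured : ∀ {a b m} → Path Coloured a b m → Set
  WellColoured []            = ⊤
  WellColoured ((c , _) ∷ P) = WellColoured P × (Avoids c P ⊎ StartsWith c P)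

  paint-++-wellColoured : ∀ {c a x b s m} (S : Path (F c) a x s) (Q : Path Coloured x b m) →
                          WellColoured Q → Avoids c Q → WellColoured (paint c S ++ Q)
  paint-++-wellColoured []           Q wc c∉Q = wc
  paint-++-wellColoured (e ∷ [])     Q wc c∉Q = wc , inj₁ c∉Q
  paint-++-wellColoured (e ∷ e′ ∷ S) Q wc c∉Q = paint-++-wellColoured (e′ ∷ S) Q wc c∉Q , inj₂ refl

wellColoured⇒isGood : ∀ {k V} {F : Fin k → V → V → Set} {a b m} (P : Path (Coloured {F = F}) a b m) →
                      WellColoured P → IsGood (colours P)
wellColoured⇒isGood (e ∷ P) (wc , _) zero zero l _ _ _ = refl
wellColoured⇒isGood (e ∷ P) (wc , inj₁ c∉P) zero (suc j) (suc l) _ _ eq = contradiction (sym eq) (c∉P l)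
wellColoured⇒isGood (e ∷ e′ ∷ P) (wc , inj₂ refl) zero (suc j) (suc l) _ j≤l eq =
  wellColoured⇒isGood (e′ ∷ P) wc zero j l z≤n (s≤s⁻¹ j≤l) eq
wellColoured⇒isGood (e ∷ P) (wc , _) (suc i) (suc j) (suc l) i≤j j≤l eq =
  wellColoured⇒isGood P wc i j l (s≤s⁻¹ i≤j) (s≤s⁻¹ j≤l) eq

module _ {n : ℕ} (G : Graph n) where

  Adj-sym : Symmetric (Adj G)
  Adj-sym {u} {v} e = trans (Graph.sym G v u) e

  Adj? : Decidable₂ (Adj G)
  Adj? u v = adj G u v Bool.≟ true

  fromWalk : ∀ {a b} (W : Walk G a b) → Path (Adj G) a b (len W)
  fromWalk W = subst₂ (λ x y → Path (Adj G) x y (len W)) (start W) (end W) (tabulate (len W) (vert W) (step W))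

  toWalk : ∀ {E a b m} → E ⇒ Adj G → Path E a b m → Walk G a b
  toWalk E⇒Adj P = record
    { len = _ ; vert = vertex P ; start = refl ; end = vertex-last P ; step = λ i → E⇒Adj (edge P i) }

module Distance {n : ℕ} (G : Graph n) (connected : Connected G) where

  private
    nearest : ∀ a b → Σ ℕ λ m → Path (Adj G) a b m × (∀ {j} → j < m → ¬ Path (Adj G) a b j)
    nearest a b = least (λ m → path? (Adj? G) m a b) (fromWalk G (connected a b))

  dist : Fin n → Fin n → ℕ
  dist a b = proj₁ (nearest a b)

  geodesic : ∀ a b → Path (Adj G) a b (dist a b)
  geodesic a b = proj₁ (proj₂ (nearest a b))

  dist-minimal : ∀ {a b m} → Path (Adj G) a b m → dist a b ≤ m
  dist-minimal {a} {b} P = ≮⇒≥ λ m<d → proj₂ (proj₂ (nearest a b)) m<d P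

  dist-triangle : ∀ a x b → dist a b ≤ dist a x + dist x b
  dist-triangle a x b = dist-minimal (geodesic a x ++ geodesic x b)

  dist-sym : ∀ a b → dist a b ≡ dist b a
  dist-sym a b = ≤-antisym (dist-minimal (reverse (Adj-sym G) (geodesic b a)))
                           (dist-minimal (reverse (Adj-sym G) (geodesic a b)))

  dist≡0⇒≡ : ∀ {a b} → dist a b ≡ 0 → a ≡ b
  dist≡0⇒≡ {a} {b} d≡0 = empty⇒≡ (subst (Path (Adj G) a b) d≡0 (geodesic a b))

  geodesic-split : ∀ {a y b s t} → Path (Adj G) a y s → Path (Adj G) y b t → s + t ≡ dist a b →
                   dist a y ≡ s × dist y b ≡ t
  geodesic-split {a} {y} {b} P Q s+t≡d =
    +-≤-tight (dist-minimal P) (dist-minimal Q) (subst (_≤ dist a y + dist y b) (sym s+t≡d) (dist-triangle a y b))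

  OnGeodesic : Fin n → Fin n → Fin n → Set
  OnGeodesic a b x = dist a x + dist x b ≡ dist a b

  geodesic-split-onGeodesic : ∀ {a y b s t} → Path (Adj G) a y s → Path (Adj G) y b t → s + t ≡ dist a b →
                              OnGeodesic a b y
  geodesic-split-onGeodesic P Q s+t≡d =
    let ay≡s , yb≡t = geodesic-split P Q s+t≡d in trans (cong₂ _+_ ay≡s yb≡t) s+t≡d

  geodesic-infix : ∀ {a u v b r s t} → Path (Adj G) a u r → Path (Adj G) u v s → Path (Adj G) v b t →
                   r + (s + t) ≡ dist a b → dist u v ≡ s
  geodesic-infix P Q R r+s+t≡d =
    proj₁ (geodesic-split Q R (sym (proj₂ (geodesic-split P (Q ++ R) r+s+t≡d))))

  shortest-length : ∀ {a b} (W : Walk G a b) → IsShortest W → len W ≡ dist a b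
  shortest-length W W-shortest =
    ≤-antisym (W-shortest (toWalk G (λ e → e) (geodesic _ _))) (dist-minimal (fromWalk G W))

  shortest-segment : ∀ {E a b} (W : Walk G a b) → IsShortest W → E ⇒ Adj G →
                     (∀ i → E (vert W (inject₁ i)) (vert W (suc i))) →
                     ∀ {p q} → toℕ p ≤ toℕ q → Path E (vert W p) (vert W q) (dist (vert W p) (vert W q))
  shortest-segment {E} {a} {b} W W-shortest E⇒Adj E-step {p} {q} p≤q =
    let r , P₁ , r≡p   = seg zero p z≤n
        s , P₂ , p+s≡q = seg p q p≤q
        t , P₃ , q+t≡L = seg q (fromℕ L) q≤L
        middle-length = geodesic-infix (forget P₁) (forget P₂) (forget P₃) (lengths r≡p p+s≡q q+t≡L)
    in  subst (Path E _ _) (sym middle-length) P₂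
    where
    open ≡-Reasoning
    L = len W
    seg = segment L (vert W) E-step
    forget = map E⇒Adj
    q≤L : toℕ q ≤ toℕ (fromℕ L)
    q≤L = subst (toℕ q ≤_) (sym (toℕ-fromℕ L)) (s≤s⁻¹ (toℕ<n q))
    lengths : ∀ {r s t} → r ≡ toℕ p → toℕ p + s ≡ toℕ q → toℕ q + t ≡ toℕ (fromℕ L) →
              r + (s + t) ≡ dist (vert W zero) (vert W (fromℕ L))
    lengths {s = s} {t} refl p+s≡q q+t≡L = begin
      toℕ p + (s + t) ≡⟨ sym (+-assoc (toℕ p) s t) ⟩
      toℕ p + s + t   ≡⟨ cong (_+ t) p+s≡q ⟩
      toℕ q + t       ≡⟨ q+t≡L ⟩
      toℕ (fromℕ L)   ≡⟨ toℕ-fromℕ L ⟩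
      L               ≡⟨ shortest-length W W-shortest ⟩
      dist a b        ≡⟨ cong₂ dist (sym (start W)) (sym (end W)) ⟩
      dist (vert W zero) (vert W (fromℕ L)) ∎

  module _ {E : Fin n → Fin n → Set} (E⇒Adj : E ⇒ Adj G) {a b} (P : Path E a b (dist a b)) where

    geodesic-vertex-dist : ∀ i → dist a (vertex P i) ≡ toℕ i
    geodesic-vertex-dist i =
      let t , P₁ , P₂ , eq = splitAt P i in proj₁ (geodesic-split (map E⇒Adj P₁) (map E⇒Adj P₂) eq)

    toWalk-isPath : IsPath (toWalk G E⇒Adj P)
    toWalk-isPath {i} {j} eq =
      toℕ-injective (trans (sym (geodesic-vertex-dist i)) (trans (cong (dist a) eq) (geodesic-vertex-dist j)))

    toWalk-isShortest : IsShortest (toWalk G E⇒Adj P)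
    toWalk-isShortest W = dist-minimal (fromWalk G W)

module BaseColouring {n : ℕ} (G : Graph n) (connected : Connected G)
                     {k : ℕ} (μ : Fin k → BasePath G) (cover : Covers μ) where

  open Distance G connected

  BaseEdge : Fin k → Fin n → Fin n → Set
  BaseEdge c u v = EdgeOf u v (walk (μ c))

  BaseEdge-sym : ∀ {c} → Symmetric (BaseEdge c)
  BaseEdge-sym (i , inj₁ uv) = i , inj₂ uv
  BaseEdge-sym (i , inj₂ vu) = i , inj₁ vu

  BaseEdge⇒Adj : ∀ {c} → BaseEdge c ⇒ Adj G
  BaseEdge⇒Adj {c} (i , inj₁ (refl , refl)) = step (walk (μ c)) i
  BaseEdge⇒Adj {c} (i , inj₂ (refl , refl)) = Adj-sym G (step (walk (μ c)) i)

  OnBase : Fin k → Fin n → Set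
  OnBase c v = ∃ λ q → vert (walk (μ c)) q ≡ v

  onBase? : ∀ c v → Dec (OnBase c v)
  onBase? c v = any? λ q → vert (walk (μ c)) q ≟ᶠ v

  BaseEdge⇒onBase : ∀ {c u v} → BaseEdge c u v → OnBase c u × OnBase c v
  BaseEdge⇒onBase (i , inj₁ (u , v)) = (inject₁ i , u) , (suc i , v)
  BaseEdge⇒onBase (i , inj₂ (v , u)) = (suc i , u) , (inject₁ i , v)

  base-segment : ∀ c {p q} → toℕ p ≤ toℕ q →
                 let f = vert (walk (μ c)) in Path (BaseEdge c) (f p) (f q) (dist (f p) (f q))
  base-segment c = shortest-segment (walk (μ c)) (shortest (μ c)) BaseEdge⇒Adj (λ i → i , inj₁ (refl , refl))

  base-geodesic : ∀ {c u v} → OnBase c u → OnBase c v → Path (BaseEdge c) u v (dist u v)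
  base-geodesic {c} (p , refl) (q , refl) with ≤-total (toℕ p) (toℕ q)
  ... | inj₁ p≤q = base-segment c p≤q
  ... | inj₂ q≤p = subst (Path (BaseEdge c) _ _) (dist-sym _ _) (reverse BaseEdge-sym (base-segment c q≤p))

  Reach : Fin n → Fin n → ℕ → Set
  Reach a b m = Σ (Fin k) λ c → OnBase c a × Σ (Fin n) λ x → OnBase c x × dist a x ≡ m × OnGeodesic a b x

  reach? : ∀ a b m → Dec (Reach a b m)
  reach? a b m = any? λ c → onBase? c a ×-dec any? λ x →
    onBase? c x ×-dec (dist a x ≟ m ×-dec dist a x + dist x b ≟ dist a b)

  reach≤dist : ∀ {a b m} → Reach a b m → m ≤ dist a b
  reach≤dist {a} (_ , _ , x , _ , refl , x-geo) = subst (dist a x ≤_) x-geo (m≤m+n _ _)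

  split⇒reach : ∀ {a y b c s t} → OnBase c a → OnBase c y →
                Path (Adj G) a y s → Path (Adj G) y b t → s + t ≡ dist a b → Reach a b s
  split⇒reach a∈c y∈c P Q s+t≡d =
    _ , a∈c , _ , y∈c , proj₁ (geodesic-split P Q s+t≡d) , geodesic-split-onGeodesic P Q s+t≡d

  reach-1 : ∀ {a b d} → dist a b ≡ suc d → Reach a b 1
  reach-1 {a} {b} ab≡1+d with subst (Path (Adj G) a b) ab≡1+d (geodesic a b)
  ... | e ∷ P =
    let a∈c , v∈c = BaseEdge⇒onBase (proj₂ (cover a _ e))
    in  split⇒reach a∈c v∈c (e ∷ []) P (sym ab≡1+d)

  ColouredPath : Fin n → Fin n → ℕ → Set
  ColouredPath = Path (Coloured {F = BaseEdge})

  Coloured⇒Adj : Coloured {F = BaseEdge} ⇒ Adj G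
  Coloured⇒Adj (_ , e) = BaseEdge⇒Adj e

  farthest-reach-avoids : ∀ {a b c x} → OnBase c a → OnGeodesic a b x →
                          (∀ {j} → Reach a b j → j ≤ dist a x) →
                          (Q : ColouredPath x b (dist x b)) → Avoids c Q
  farthest-reach-avoids {a} {b} {x = x} a∈c x-geo farthest Q l refl with splitAt Q (suc l)
  ... | t , Q₁ , Q₂ , l+1+t≡xb =
    m+1+n≰m (dist a x)
      (farthest (split⇒reach a∈c y∈c (geodesic a x ++ map Coloured⇒Adj Q₁) (map Coloured⇒Adj Q₂) lengths))
    where
    open ≡-Reasoning
    y∈c = proj₂ (BaseEdge⇒onBase (proj₂ (edge Q l)))
    lengths : dist a x + suc (toℕ l) + t ≡ dist a b
    lengths = begin
      dist a x + suc (toℕ l) + t   ≡⟨ +-assoc (dist a x) _ t ⟩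
      dist a x + (suc (toℕ l) + t) ≡⟨ cong (dist a x +_) l+1+t≡xb ⟩
      dist a x + dist x b          ≡⟨ x-geo ⟩
      dist a b ∎

  WellColouredPath : Fin n → Fin n → ℕ → Set
  WellColouredPath a b m = Σ (ColouredPath a b m) WellColoured

  wellColoured-geodesic : ∀ a b → WellColouredPath a b (dist a b)
  wellColoured-geodesic a b =
    <-rec (λ d → ∀ a b → dist a b ≡ d → WellColouredPath a b (dist a b)) extend (dist a b) a b refl
    where
    extend : ∀ d → (∀ {d′} → d′ < d → ∀ x b → dist x b ≡ d′ → WellColouredPath x b (dist x b)) →
             ∀ a b → dist a b ≡ d → WellColouredPath a b (dist a b)
    extend zero _ a b ab≡0 with dist≡0⇒≡ ab≡0
    ... | refl = subst (WellColouredPath a a) (sym ab≡0) ([] , tt)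
    extend (suc d) recurse a b ab≡1+d with greatest (reach? a b) reach≤dist (reach-1 ab≡1+d)
    ... | _ , (c , a∈c , x , x∈c , refl , x-geo) , farthest =
      let Q , Q-wc = recurse xb<1+d x b refl
          S = base-geodesic a∈c x∈c
      in  subst (WellColouredPath a b) x-geo
            (paint c S ++ Q , paint-++-wellColoured S Q Q-wc (farthest-reach-avoids a∈c x-geo farthest Q))
      where
      xb<1+d : dist x b < suc d
      xb<1+d = subst (suc (dist x b) ≤_) (trans x-geo ab≡1+d)
                     (+-monoˡ-≤ (dist x b) (farthest (reach-1 ab≡1+d)))

lemma6 : (n : ℕ) (G : Graph n) → Connected G →
         (k : ℕ) (μ : Fin k → BasePath G) → Covers μ →
         (a b : Fin n) →
         Σ (Walk G a b) λ P → IsPath P × IsShortest P ×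
           Σ (Fin (len P) → Fin k) λ col → IsColouring μ P col × IsGood col
lemma6 n G connected k μ cover a b =
  let Q , Q-wc = wellColoured-geodesic a b
  in  toWalk G Coloured⇒Adj Q , toWalk-isPath Coloured⇒Adj Q , toWalk-isShortest Coloured⇒Adj Q ,
      colours Q , (λ i → proj₂ (edge Q i)) , wellColoured⇒isGood Q Q-wc
  where
  open Distance G connected
  open BaseColouring G connected μ cover
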